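{- For each $n<\omega$, the set of formulas $\{\Diamond_nF,\ \nabla_nG : F,G\in\mathcal{F}^\nabla_n\}$ is linearly ordered by provability in $\mathrm{RC}^\nabla$: for any two formulas $X,Y$ in this set, $X\vdash Y$ or $Y\vdash X$ is provable in $\mathrm{RC}^\nabla$.
   Context: Strictly positive formulas are built from propositional variables and $\top$ by $\land$ and unary modalities $\Diamond_n,\nabla_n$ ($n<\omega$). $\mathcal{F}^\nabla_n$ is the set of variable-free strictly positive formulas using only modalities $\Diamond_i,\nabla_i$ with $i\ge n$. $\mathrm{RC}^\nabla$ is the smallest set of sequents $A\vdash B$ containing the following axioms and closed under the following rules and under substitution: (1) $A\vdash A$; $A\vdash\top$; $A\land B\vdash A$; $A\land B\vdash B$; from $A\vdash B$, $B\vdash C$ infer $A\vdash C$; from $A\vdash B$, $A\vdash C$ infer $A\vdash B\land C$; from $A\vdash B$ infer $aA\vdash aB$ for each modality $a$; (2) $aaA\vdash aA$ for each modality $a$; (3) for $m<n$: $\Diamond_nA\vdash\Diamond_mA$, $\Diamond_nA\land\Diamond_mB\vdash\Diamond_n(A\land\Diamond_mB)$, and the same two with $\nabla$ in place of $\Diamond$; (4) $A\vdash\nabla_nA$, $\Diamond_nA\vdash\nabla_nA$; (5) for $m\le n$: $\Diamond_m\nabla_nA\vdash\Diamond_mA$, $\nabla_n\Diamond_mA\vdash\Diamond_mA$. -}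

module Defs where

open import Data.Nat using (ℕ; _≤_; _<_)
open import Data.Product using (Σ; _×_)
open import Data.Sum using (_⊎_)
open import Relation.Binary.PropositionalEquality using (_≡_)

data Mod : Set where
  dia : ℕ → Mod
  nab : ℕ → Mod

infixr 6 _∧_
data Fm : Set where
  var : ℕ → Fm
  ⊤   : Fm
  _∧_ : Fm → Fm → Fm
  ⟨_⟩_ : Mod → Fm → Fm

◇ : ℕ → Fm → Fm
◇ n A = ⟨ dia n ⟩ A

∇ : ℕ → Fm → Fm
∇ n A = ⟨ nab n ⟩ A

sub : (ℕ → Fm) → Fm → Fm
sub σ (var x) = σ x
sub σ ⊤ = ⊤
sub σ (A ∧ B) = sub σ A ∧ sub σ B
sub σ (⟨ a ⟩ A) = ⟨ a ⟩ sub σ A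

infix 4 _⊢_
data _⊢_ : Fm → Fm → Set where
  refl   : ∀ {A} → A ⊢ A
  top    : ∀ {A} → A ⊢ ⊤
  ∧-e₁   : ∀ {A B} → A ∧ B ⊢ A
  ∧-e₂   : ∀ {A B} → A ∧ B ⊢ B
  cut    : ∀ {A B C} → A ⊢ B → B ⊢ C → A ⊢ C
  ∧-i    : ∀ {A B C} → A ⊢ B → A ⊢ C → A ⊢ B ∧ C
  mono   : ∀ {A B} a → A ⊢ B → ⟨ a ⟩ A ⊢ ⟨ a ⟩ B
  trans4 : ∀ {A} a → ⟨ a ⟩ ⟨ a ⟩ A ⊢ ⟨ a ⟩ A
  ◇-mon  : ∀ {A m n} → m < n → ◇ n A ⊢ ◇ m A
  ◇-J    : ∀ {A B m n} → m < n → ◇ n A ∧ ◇ m B ⊢ ◇ n (A ∧ ◇ m B)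
  ∇-mon  : ∀ {A m n} → m < n → ∇ n A ⊢ ∇ m A
  ∇-J    : ∀ {A B m n} → m < n → ∇ n A ∧ ∇ m B ⊢ ∇ n (A ∧ ∇ m B)
  ∇-refl : ∀ {A n} → A ⊢ ∇ n A
  ◇∇     : ∀ {A n} → ◇ n A ⊢ ∇ n A
  ◇∇-red : ∀ {A m n} → m ≤ n → ◇ m (∇ n A) ⊢ ◇ m A
  ∇◇-red : ∀ {A m n} → m ≤ n → ∇ n (◇ m A) ⊢ ◇ m A
  subst  : ∀ {A B} (σ : ℕ → Fm) → A ⊢ B → sub σ A ⊢ sub σ B

data ModGe (n : ℕ) : Mod → Set where
  dia≥ : ∀ {i} → n ≤ i → ModGe n (dia i)
  nab≥ : ∀ {i} → n ≤ i → ModGe n (nab i)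

data InF (n : ℕ) : Fm → Set where
  ⊤∈ : InF n ⊤
  ∧∈ : ∀ {A B} → InF n A → InF n B → InF n (A ∧ B)
  ⟨⟩∈ : ∀ {a A} → ModGe n a → InF n A → InF n (⟨ a ⟩ A)

InSet : ℕ → Fm → Set
InSet n X = Σ Fm (λ F → InF n F × ((X ≡ ◇ n F) ⊎ (X ≡ ∇ n F)))

-- For F, G ∈ 𝓕ₙ one shows F ⊢ ◇ₙ G or G ⊢ ∇ₙ F, from which the four cases of the theorem follow at once.
-- The proof is by induction on the number of modal levels in use and then on the size of F and G.
-- Modulo ∇ₙ (F ≈ₙ G iff F ⊢ ∇ₙ G and G ⊢ ∇ₙ F, a relation the claim respects) every F ∈ 𝓕ₙ is Q ∧ H
-- with Q either ⊤ or ◇ₙ B and H ∈ 𝓕ₙ₊₁. For two such normal forms the H parts are comparable at level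
-- n+1, each ◇ₙ B is compared with the other formula by the size induction, and the axioms J for ◇ and ∇
-- assemble the comparison at level n. The normal form is reached in two stages: first F ⊣⊢ P ∧ H with a
-- head P among ⊤, ◇ₙ B, ∇ₙ A (the heads of a conjunction merge, since heads are linearly ordered by the
-- size induction); then a head ∇ₙ A is replaced by the normal form of A, which holds only up to ≈ₙ.
module Submission where

open import Defs
open import Data.Nat using (ℕ; zero; suc; _+_; _⊔_; _≤_; _<_; z≤n; s≤s)
open import Data.Nat.Properties
  using (≤-refl; ≤-trans; <-≤-trans; ≤-<-trans; <⇒≤; ≤-pred; n≮0; n≮n; n<1+n; n≤1+n; m<n⇒m<1+n;
         m≤n⇒m≤1+n; m≤n⇒m<n∨m≡n; m≤m+n; m≤n+m; +-mono-≤; +-monoʳ-<; +-comm; +-suc; m≤m⊔n; m≤n⊔m)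
open import Data.Product using (_×_; _,_)
open import Data.Sum using (_⊎_; inj₁; inj₂; swap)
open import Data.Unit using () renaming (⊤ to Unit; tt to unit)
open import Data.Empty using (⊥-elim)
open import Relation.Binary.PropositionalEquality using (sym) renaming (refl to ≡-refl; subst to ≡-subst)

infixr 5 _⨾_
_⨾_ : ∀ {A B C} → A ⊢ B → B ⊢ C → A ⊢ C
_⨾_ = cut

infix 4 _⊣⊢_
_⊣⊢_ : Fm → Fm → Set
A ⊣⊢ B = (A ⊢ B) × (B ⊢ A)

⊣⊢-trans : ∀ {A B C} → A ⊣⊢ B → B ⊣⊢ C → A ⊣⊢ C
⊣⊢-trans (A⊢B , B⊢A) (B⊢C , C⊢B) = A⊢B ⨾ B⊢C , C⊢B ⨾ B⊢A

mono-⊣⊢ : ∀ {A B} a → A ⊣⊢ B → ⟨ a ⟩ A ⊣⊢ ⟨ a ⟩ B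
mono-⊣⊢ a (A⊢B , B⊢A) = mono a A⊢B , mono a B⊢A

∧-swap : ∀ {A B} → A ∧ B ⊢ B ∧ A
∧-swap = ∧-i ∧-e₂ ∧-e₁

∧-cong : ∀ {A₁ A₂ B₁ B₂} → A₁ ⊣⊢ B₁ → A₂ ⊣⊢ B₂ → A₁ ∧ A₂ ⊣⊢ B₁ ∧ B₂
∧-cong (A₁⊢B₁ , B₁⊢A₁) (A₂⊢B₂ , B₂⊢A₂) =
  ∧-i (∧-e₁ ⨾ A₁⊢B₁) (∧-e₂ ⨾ A₂⊢B₂) , ∧-i (∧-e₁ ⨾ B₁⊢A₁) (∧-e₂ ⨾ B₂⊢A₂)

∇-mon-≤ : ∀ {A m n} → m ≤ n → ∇ n A ⊢ ∇ m A
∇-mon-≤ m≤n with m≤n⇒m<n∨m≡n m≤n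
... | inj₁ m<n = ∇-mon m<n
... | inj₂ ≡-refl = refl

∇-lift : ∀ {n A B} → A ⊢ ∇ n B → ∇ n A ⊢ ∇ n B
∇-lift {n} A⊢∇B = mono (nab n) A⊢∇B ⨾ trans4 (nab n)

◇-lift : ∀ {n A B} → A ⊢ ∇ n B → ◇ n A ⊢ ◇ n B
◇-lift {n} A⊢∇B = mono (dia n) A⊢∇B ⨾ ◇∇-red ≤-refl

∇◇-absorb : ∀ {n A} → ∇ n (◇ n A) ⊢ ◇ n A
∇◇-absorb = ∇◇-red ≤-refl

infix 4 _≈[_]_
_≈[_]_ : Fm → ℕ → Fm → Set
F ≈[ n ] G = (F ⊢ ∇ n G) × (G ⊢ ∇ n F)

≈-sym : ∀ {n F G} → F ≈[ n ] G → G ≈[ n ] F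
≈-sym (F⊢∇G , G⊢∇F) = G⊢∇F , F⊢∇G

≈-trans : ∀ {n F G H} → F ≈[ n ] G → G ≈[ n ] H → F ≈[ n ] H
≈-trans (F⊢∇G , G⊢∇F) (G⊢∇H , H⊢∇G) = F⊢∇G ⨾ ∇-lift G⊢∇H , H⊢∇G ⨾ ∇-lift G⊢∇F

≈-refl : ∀ {n F} → F ≈[ n ] F
≈-refl = ∇-refl , ∇-refl

⊣⊢⇒≈ : ∀ {n F G} → F ⊣⊢ G → F ≈[ n ] G
⊣⊢⇒≈ (F⊢G , G⊢F) = F⊢G ⨾ ∇-refl , G⊢F ⨾ ∇-refl

Comparable : ℕ → Fm → Fm → Set
Comparable n F G = (F ⊢ ◇ n G) ⊎ (G ⊢ ∇ n F)

comparable-resp : ∀ {n F G F′ G′} → F ≈[ n ] F′ → G ≈[ n ] G′ → Comparable n F G → Comparable n F′ G′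
comparable-resp {n} (F⊢∇F′ , F′⊢∇F) (G⊢∇G′ , G′⊢∇G) (inj₁ F⊢◇G) =
  inj₁ (F′⊢∇F ⨾ mono (nab n) F⊢◇G ⨾ ∇◇-absorb ⨾ ◇-lift G⊢∇G′)
comparable-resp (F⊢∇F′ , F′⊢∇F) (G⊢∇G′ , G′⊢∇G) (inj₂ G⊢∇F) =
  inj₂ (G′⊢∇G ⨾ ∇-lift G⊢∇F ⨾ ∇-lift F⊢∇F′)

data Head (n : ℕ) : Fm → Set where
  ⊤ₕ : Head n ⊤
  ◇ₕ : ∀ B → Head n (◇ n B)
  ∇ₕ : ∀ A → Head n (∇ n A)

data ReducedHead (n : ℕ) : Fm → Set where
  ⊤ᵣ : ReducedHead n ⊤
  ◇ᵣ : ∀ B → ReducedHead n (◇ n B)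

reducedHead⇒head : ∀ {n Q} → ReducedHead n Q → Head n Q
reducedHead⇒head ⊤ᵣ = ⊤ₕ
reducedHead⇒head (◇ᵣ B) = ◇ₕ B

∇-head : ∀ {n i P} → n ≤ i → Head n P → ∇ i P ⊢ P
∇-head _ ⊤ₕ = top
∇-head n≤i (◇ₕ B) = ∇◇-red n≤i
∇-head {n} n≤i (∇ₕ A) = ∇-mon-≤ n≤i ⨾ trans4 (nab n)

head-linear : ∀ {n P₁ P₂} → Head n P₁ → Head n P₂ → Comparable n P₁ P₂ → (P₁ ⊢ P₂) ⊎ (P₂ ⊢ P₁)
head-linear _ h₂ (inj₁ P₁⊢◇P₂) = inj₁ (P₁⊢◇P₂ ⨾ ◇∇ ⨾ ∇-head ≤-refl h₂)
head-linear h₁ _ (inj₂ P₂⊢∇P₁) = inj₂ (P₂⊢∇P₁ ⨾ ∇-head ≤-refl h₁)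

∧-merge-heads : ∀ {P₁ H₁ P₂ H₂} → P₁ ⊢ P₂ → (P₁ ∧ H₁) ∧ (P₂ ∧ H₂) ⊣⊢ P₁ ∧ (H₁ ∧ H₂)
∧-merge-heads P₁⊢P₂ =
  ∧-i (∧-e₁ ⨾ ∧-e₁) (∧-i (∧-e₁ ⨾ ∧-e₂) (∧-e₂ ⨾ ∧-e₂)) ,
  ∧-i (∧-i ∧-e₁ (∧-e₂ ⨾ ∧-e₁)) (∧-i (∧-e₁ ⨾ P₁⊢P₂) (∧-e₂ ⨾ ∧-e₂))

◇-⊤-split : ∀ {i H} → ◇ i (⊤ ∧ H) ⊣⊢ ⊤ ∧ ◇ i H
◇-⊤-split {i} = ∧-i top (mono (dia i) ∧-e₂) , ∧-e₂ ⨾ mono (dia i) (∧-i top refl)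

◇-◇-split : ∀ {n i B H} → n < i → ◇ i (◇ n B ∧ H) ⊣⊢ ◇ n B ∧ ◇ i H
◇-◇-split {n} {i} n<i =
  ∧-i (mono (dia i) ∧-e₁ ⨾ ◇-mon n<i ⨾ trans4 (dia n)) (mono (dia i) ∧-e₂) ,
  ∧-swap ⨾ ◇-J n<i ⨾ mono (dia i) ∧-swap

◇-∇-split : ∀ {n i B H} → n < i → ◇ i (∇ n B ∧ H) ⊣⊢ ◇ n B ∧ ◇ i H
◇-∇-split {n} {i} n<i =
  ∧-i (mono (dia i) ∧-e₁ ⨾ ◇-mon n<i ⨾ ◇∇-red ≤-refl) (mono (dia i) ∧-e₂) ,
  ∧-swap ⨾ ◇-J n<i ⨾ mono (dia i) (∧-i (∧-e₂ ⨾ ◇∇) ∧-e₁)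

∇-split : ∀ {n i P H} → n < i → Head n P → ∇ i (P ∧ H) ⊣⊢ P ∧ ∇ i H
∇-split {i = i} n<i h =
  ∧-i (mono (nab i) ∧-e₁ ⨾ ∇-head (<⇒≤ n<i) h) (mono (nab i) ∧-e₂) ,
  ∧-i ∧-e₂ (∧-e₁ ⨾ ∇-refl) ⨾ ∇-J n<i ⨾ mono (nab i) (∧-i (∧-e₂ ⨾ ∇-head ≤-refl h) ∧-e₁)

-- In ∇ₙ A ∧ H with A ≈ₙ Q ∧ H′, whichever of H, H′ is stronger modulo ∇ₘ absorbs the other.

∇-reduce-outer : ∀ {n m A Q H′ H} → n < m → Head n Q → A ≈[ n ] Q ∧ H′ → H ⊢ ∇ m H′
  → ∇ n A ∧ H ≈[ n ] Q ∧ H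
∇-reduce-outer {n} {m} {A} {Q} {H′} {H} n<m q (A⊢∇QH′ , QH′⊢∇A) H⊢∇H′ =
  ∧-i (∧-e₁ ⨾ ∇-lift A⊢∇QH′ ⨾ mono (nab n) ∧-e₁ ⨾ ∇-head ≤-refl q) ∧-e₂ ⨾ ∇-refl ,
  ∧-i QH⊢∇A ∧-e₂ ⨾ ∇-refl
  where
  QH⊢∇A : Q ∧ H ⊢ ∇ n A
  QH⊢∇A = ∧-i (∧-e₂ ⨾ H⊢∇H′) (∧-e₁ ⨾ ∇-refl) ⨾ ∇-J n<m ⨾ ∇-mon n<m
        ⨾ mono (nab n) (∧-i (∧-e₂ ⨾ ∇-head ≤-refl q) ∧-e₁) ⨾ ∇-lift QH′⊢∇A

∇-reduce-inner : ∀ {n m A Q H′ H} → n < m → A ≈[ n ] Q ∧ H′ → H′ ⊢ ∇ m H → ∇ n A ∧ H ≈[ n ] Q ∧ H′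
∇-reduce-inner {n} n<m (A⊢∇QH′ , QH′⊢∇A) H′⊢∇H =
  ∧-e₁ ⨾ ∇-lift A⊢∇QH′ ,
  ∧-i (∧-e₂ ⨾ H′⊢∇H) QH′⊢∇A ⨾ ∇-J n<m ⨾ ∇-mon n<m ⨾ mono (nab n) ∧-swap

HeadComparable : ∀ {n Q} → ReducedHead n Q → Fm → Set
HeadComparable ⊤ᵣ F = Unit
HeadComparable {n} (◇ᵣ B) F = Comparable n F B

compare-reduced : ∀ {n m Q H Q′ H′} (q : ReducedHead n Q) (q′ : ReducedHead n Q′) → n < m
  → Comparable m H H′ → HeadComparable q′ (Q ∧ H) → HeadComparable q (Q′ ∧ H′)
  → Comparable n (Q ∧ H) (Q′ ∧ H′)
compare-reduced {n} _ ⊤ᵣ n<m (inj₁ H⊢◇H′) _ _ =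
  inj₁ (∧-e₂ ⨾ H⊢◇H′ ⨾ ◇-mon n<m ⨾ mono (dia n) (∧-i top refl))
compare-reduced {n} _ (◇ᵣ B′) n<m (inj₁ H⊢◇H′) (inj₁ QH⊢◇B′) _ =
  inj₁ (∧-i (∧-e₂ ⨾ H⊢◇H′) QH⊢◇B′ ⨾ ◇-J n<m ⨾ ◇-mon n<m ⨾ mono (dia n) ∧-swap)
compare-reduced _ (◇ᵣ B′) _ (inj₁ _) (inj₂ B′⊢∇QH) _ =
  inj₂ (∧-e₁ ⨾ ◇-lift B′⊢∇QH ⨾ ◇∇)
compare-reduced {n} ⊤ᵣ _ n<m (inj₂ H′⊢∇H) _ _ =
  inj₂ (∧-e₂ ⨾ H′⊢∇H ⨾ ∇-mon n<m ⨾ mono (nab n) (∧-i top refl))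
compare-reduced {n} (◇ᵣ B) _ n<m (inj₂ H′⊢∇H) _ (inj₁ Q′H′⊢◇B) =
  inj₂ (∧-i (∧-e₂ ⨾ H′⊢∇H) (Q′H′⊢◇B ⨾ ∇-refl) ⨾ ∇-J n<m ⨾ ∇-mon n<m
        ⨾ mono (nab n) (∧-i (∧-e₂ ⨾ ∇◇-absorb) ∧-e₁))
compare-reduced (◇ᵣ B) _ _ (inj₂ _) _ (inj₂ B⊢∇Q′H′) =
  inj₁ (∧-e₁ ⨾ ◇-lift B⊢∇Q′H′)

level : Mod → ℕ
level (dia i) = i
level (nab i) = i

data Bounded (n U : ℕ) : Fm → Set where
  ⊤b : Bounded n U ⊤
  ∧b : ∀ {A B} → Bounded n U A → Bounded n U B → Bounded n U (A ∧ B)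
  ⟨⟩b : ∀ {a A} → n ≤ level a → level a < U → Bounded n U A → Bounded n U (⟨ a ⟩ A)

bounded-empty⇒⊢ : ∀ {n U F} → U ≤ n → Bounded n U F → ∀ {G} → G ⊢ F
bounded-empty⇒⊢ _ ⊤b = top
bounded-empty⇒⊢ U≤n (∧b bA bB) = ∧-i (bounded-empty⇒⊢ U≤n bA) (bounded-empty⇒⊢ U≤n bB)
bounded-empty⇒⊢ {n} U≤n (⟨⟩b n≤i i<U _) = ⊥-elim (n≮n n (≤-<-trans n≤i (<-≤-trans i<U U≤n)))

size : Fm → ℕ
size (var _) = 1
size ⊤ = 1
size (A ∧ B) = suc (size A + size B)
size (⟨ a ⟩ A) = suc (size A)

0<size : ∀ F → 0 < size F
0<size (var _) = s≤s z≤n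
0<size ⊤ = s≤s z≤n
0<size (_ ∧ _) = s≤s z≤n
0<size (⟨ _ ⟩ _) = s≤s z≤n

size-∧ˡ : ∀ A B → size A ≤ size (A ∧ B)
size-∧ˡ A B = m≤n⇒m≤1+n (m≤m+n (size A) (size B))

size-∧ʳ : ∀ A B → size B ≤ size (A ∧ B)
size-∧ʳ A B = m≤n⇒m≤1+n (m≤n+m (size B) (size A))

module AtLevel (n U : ℕ)
  (comparable-above : ∀ {F G} → Bounded (suc n) U F → Bounded (suc n) U G → Comparable (suc n) F G)
  where

  ComparableBelow : ℕ → Set
  ComparableBelow k = ∀ {F G} → Bounded n U F → Bounded n U G → size F + size G < k → Comparable n F G

  record HeadSplit (F : Fm) : Set where
    constructor mkHeadSplit
    field
      P H : Fm
      head : Head n P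
      P-bounded : Bounded n U P
      H-bounded : Bounded (suc n) U H
      size-P : size P ≤ size F
      split : F ⊣⊢ P ∧ H

  headSplit-∧ : ∀ {A₁ A₂} (s₁ : HeadSplit A₁) (s₂ : HeadSplit A₂)
    → (HeadSplit.P s₁ ⊢ HeadSplit.P s₂) ⊎ (HeadSplit.P s₂ ⊢ HeadSplit.P s₁) → HeadSplit (A₁ ∧ A₂)
  headSplit-∧ {A₁} {A₂} (mkHeadSplit P₁ H₁ h₁ bP₁ bH₁ sz₁ s₁) (mkHeadSplit _ H₂ _ _ bH₂ _ s₂)
              (inj₁ P₁⊢P₂) =
    mkHeadSplit P₁ (H₁ ∧ H₂) h₁ bP₁ (∧b bH₁ bH₂) (≤-trans sz₁ (size-∧ˡ A₁ A₂))
      (⊣⊢-trans (∧-cong s₁ s₂) (∧-merge-heads P₁⊢P₂))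
  headSplit-∧ {A₁} {A₂} (mkHeadSplit _ H₁ _ _ bH₁ _ s₁) (mkHeadSplit P₂ H₂ h₂ bP₂ bH₂ sz₂ s₂)
              (inj₂ P₂⊢P₁) =
    mkHeadSplit P₂ (H₂ ∧ H₁) h₂ bP₂ (∧b bH₂ bH₁) (≤-trans sz₂ (size-∧ʳ A₁ A₂))
      (⊣⊢-trans (∧-swap , ∧-swap) (⊣⊢-trans (∧-cong s₂ s₁) (∧-merge-heads P₂⊢P₁)))

  headSplit-◇ : ∀ {i A} → n < i → i < U → HeadSplit A → HeadSplit (◇ i A)
  headSplit-◇ {i} n<i i<U (mkHeadSplit .⊤ H ⊤ₕ bP bH sz s) =
    mkHeadSplit ⊤ (◇ i H) ⊤ₕ bP (⟨⟩b n<i i<U bH) (m≤n⇒m≤1+n sz)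
      (⊣⊢-trans (mono-⊣⊢ (dia i) s) ◇-⊤-split)
  headSplit-◇ {i} n<i i<U (mkHeadSplit .(◇ n B) H (◇ₕ B) bP bH sz s) =
    mkHeadSplit (◇ n B) (◇ i H) (◇ₕ B) bP (⟨⟩b n<i i<U bH) (m≤n⇒m≤1+n sz)
      (⊣⊢-trans (mono-⊣⊢ (dia i) s) (◇-◇-split n<i))
  headSplit-◇ {i} n<i i<U (mkHeadSplit .(∇ n B) H (∇ₕ B) (⟨⟩b n≤n n<U bB) bH sz s) =
    mkHeadSplit (◇ n B) (◇ i H) (◇ₕ B) (⟨⟩b n≤n n<U bB) (⟨⟩b n<i i<U bH) (m≤n⇒m≤1+n sz)
      (⊣⊢-trans (mono-⊣⊢ (dia i) s) (◇-∇-split n<i))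

  headSplit-∇ : ∀ {i A} → n < i → i < U → HeadSplit A → HeadSplit (∇ i A)
  headSplit-∇ {i} n<i i<U (mkHeadSplit P H h bP bH sz s) =
    mkHeadSplit P (∇ i H) h bP (⟨⟩b n<i i<U bH) (m≤n⇒m≤1+n sz)
      (⊣⊢-trans (mono-⊣⊢ (nab i) s) (∇-split n<i h))

  headSplit-self : ∀ {F} → Head n F → Bounded n U F → HeadSplit F
  headSplit-self h bF = mkHeadSplit _ ⊤ h bF ⊤b ≤-refl (∧-i refl top , ∧-e₁)

  headSplit : ∀ {k F} → ComparableBelow k → Bounded n U F → size F ≤ k → HeadSplit F
  headSplit _ ⊤b _ = headSplit-self ⊤ₕ ⊤b
  headSplit IH (∧b {A₁} {A₂} b₁ b₂) A≤k =
    headSplit-∧ s₁ s₂ (head-linear (HeadSplit.head s₁) (HeadSplit.head s₂)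
      (IH (HeadSplit.P-bounded s₁) (HeadSplit.P-bounded s₂)
          (<-≤-trans (s≤s (+-mono-≤ (HeadSplit.size-P s₁) (HeadSplit.size-P s₂))) A≤k)))
    where
    s₁ : HeadSplit A₁
    s₁ = headSplit IH b₁ (≤-trans (size-∧ˡ A₁ A₂) A≤k)
    s₂ : HeadSplit A₂
    s₂ = headSplit IH b₂ (≤-trans (size-∧ʳ A₁ A₂) A≤k)
  headSplit IH (⟨⟩b {dia i} n≤i i<U bA) A≤k with m≤n⇒m<n∨m≡n n≤i
  ... | inj₁ n<i = headSplit-◇ n<i i<U (headSplit IH bA (≤-trans (n≤1+n _) A≤k))
  ... | inj₂ ≡-refl = headSplit-self (◇ₕ _) (⟨⟩b n≤i i<U bA)
  headSplit IH (⟨⟩b {nab i} n≤i i<U bA) A≤k with m≤n⇒m<n∨m≡n n≤i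
  ... | inj₁ n<i = headSplit-∇ n<i i<U (headSplit IH bA (≤-trans (n≤1+n _) A≤k))
  ... | inj₂ ≡-refl = headSplit-self (∇ₕ _) (⟨⟩b n≤i i<U bA)

  record ReducedSplit (F : Fm) : Set where
    constructor mkReducedSplit
    field
      Q H : Fm
      head : ReducedHead n Q
      Q-bounded : Bounded n U Q
      H-bounded : Bounded (suc n) U H
      size-Q : size Q ≤ size F
      equiv : F ≈[ n ] Q ∧ H

  reduce : ∀ {k F} → ComparableBelow k → Bounded n U F → size F ≤ k → ReducedSplit F
  reduce {zero} {F} _ _ F≤0 = ⊥-elim (n≮0 (<-≤-trans (0<size F) F≤0))
  reduce {suc k} IH bF F≤k with headSplit IH bF F≤k
  ... | mkHeadSplit .⊤ H ⊤ₕ bP bH sz s = mkReducedSplit ⊤ H ⊤ᵣ bP bH sz (⊣⊢⇒≈ s)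
  ... | mkHeadSplit .(◇ n B) H (◇ₕ B) bP bH sz s = mkReducedSplit (◇ n B) H (◇ᵣ B) bP bH sz (⊣⊢⇒≈ s)
  ... | mkHeadSplit .(∇ n A) H (∇ₕ A) (⟨⟩b _ _ bA) bH sz s
    with reduce (λ bF bG lt → IH bF bG (m<n⇒m<1+n lt)) bA (≤-pred (≤-trans sz F≤k))
  ... | mkReducedSplit Q H′ q bQ bH′ szQ A≈QH′ with comparable-above bH bH′
  ... | inj₁ H⊢◇H′ = mkReducedSplit Q H q bQ bH (≤-trans szQ (≤-trans (n≤1+n _) sz))
          (≈-trans (⊣⊢⇒≈ s) (∇-reduce-outer (n<1+n n) (reducedHead⇒head q) A≈QH′ (H⊢◇H′ ⨾ ◇∇)))
  ... | inj₂ H′⊢∇H = mkReducedSplit Q H′ q bQ bH′ (≤-trans szQ (≤-trans (n≤1+n _) sz))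
          (≈-trans (⊣⊢⇒≈ s) (∇-reduce-inner (n<1+n n) A≈QH′ H′⊢∇H))

  head-comparable : ∀ {k X R Q G} (q : ReducedHead n Q) → ComparableBelow k → Bounded n U X → Bounded n U Q
    → size Q ≤ size G → size X + size G ≤ k → X ≈[ n ] R → HeadComparable q R
  head-comparable ⊤ᵣ _ _ _ _ _ _ = unit
  head-comparable {X = X} (◇ᵣ B) IH bX (⟨⟩b _ _ bB) Q≤G X+G≤k X≈R =
    comparable-resp X≈R ≈-refl (IH bX bB (<-≤-trans (+-monoʳ-< (size X) Q≤G) X+G≤k))

  comparable : ∀ k {F G} → Bounded n U F → Bounded n U G → size F + size G < k → Comparable n F G
  comparable zero _ _ ()
  comparable (suc k) {F} {G} bF bG (s≤s F+G≤k) =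
    comparable-resp (≈-sym F≈) (≈-sym G≈)
      (compare-reduced qF qG (n<1+n n) (comparable-above bHF bHG)
        (head-comparable qG IH bF bQG szG F+G≤k F≈)
        (head-comparable qF IH bG bQF szF (≡-subst (_≤ k) (+-comm (size F) (size G)) F+G≤k) G≈))
    where
    IH : ComparableBelow k
    IH = comparable k
    open ReducedSplit (reduce IH bF (≤-trans (m≤m+n (size F) (size G)) F+G≤k))
      renaming (head to qF; Q-bounded to bQF; H-bounded to bHF; size-Q to szF; equiv to F≈)
    open ReducedSplit (reduce IH bG (≤-trans (m≤n+m (size G) (size F)) F+G≤k))
      renaming (head to qG; Q-bounded to bQG; H-bounded to bHG; size-Q to szG; equiv to G≈)

comparable-bounded : ∀ d n U → U ≤ d + n → ∀ {F G} → Bounded n U F → Bounded n U G → Comparable n F G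
comparable-bounded zero n U U≤n bF bG = inj₂ (bounded-empty⇒⊢ U≤n bF ⨾ ∇-refl)
comparable-bounded (suc d) n U U≤d+n {F} {G} bF bG =
  AtLevel.comparable n U (comparable-bounded d (suc n) U (≡-subst (U ≤_) (sym (+-suc d n)) U≤d+n))
    (suc (size F + size G)) bF bG ≤-refl

bound : Fm → ℕ
bound (var _) = 0
bound ⊤ = 0
bound (A ∧ B) = bound A ⊔ bound B
bound (⟨ a ⟩ A) = suc (level a) ⊔ bound A

level-ge : ∀ {n a} → ModGe n a → n ≤ level a
level-ge (dia≥ n≤i) = n≤i
level-ge (nab≥ n≤i) = n≤i

InF⇒bounded : ∀ {n U F} → InF n F → bound F ≤ U → Bounded n U F
InF⇒bounded ⊤∈ _ = ⊤b
InF⇒bounded (∧∈ {A} {B} iA iB) F≤U =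
  ∧b (InF⇒bounded iA (≤-trans (m≤m⊔n (bound A) (bound B)) F≤U))
     (InF⇒bounded iB (≤-trans (m≤n⊔m (bound A) (bound B)) F≤U))
InF⇒bounded (⟨⟩∈ {a} {A} a≥n iA) F≤U =
  ⟨⟩b (level-ge a≥n) (≤-trans (m≤m⊔n (suc (level a)) (bound A)) F≤U)
    (InF⇒bounded iA (≤-trans (m≤n⊔m (suc (level a)) (bound A)) F≤U))

comparable : ∀ n {F G} → InF n F → InF n G → Comparable n F G
comparable n {F} {G} iF iG =
  comparable-bounded U n U (m≤m+n U n)
    (InF⇒bounded iF (m≤m⊔n (bound F) (bound G))) (InF⇒bounded iG (m≤n⊔m (bound F) (bound G)))
  where
  U = bound F ⊔ bound G

◇-linear : ∀ {n F G} → Comparable n F G → (◇ n F ⊢ ◇ n G) ⊎ (◇ n G ⊢ ◇ n F)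
◇-linear (inj₁ F⊢◇G) = inj₁ (◇-lift (F⊢◇G ⨾ ◇∇))
◇-linear (inj₂ G⊢∇F) = inj₂ (◇-lift G⊢∇F)

∇-linear : ∀ {n F G} → Comparable n F G → (∇ n F ⊢ ∇ n G) ⊎ (∇ n G ⊢ ∇ n F)
∇-linear (inj₁ F⊢◇G) = inj₁ (∇-lift (F⊢◇G ⨾ ◇∇))
∇-linear (inj₂ G⊢∇F) = inj₂ (∇-lift G⊢∇F)

∇◇-linear : ∀ {n F G} → Comparable n F G → (∇ n F ⊢ ◇ n G) ⊎ (◇ n G ⊢ ∇ n F)
∇◇-linear {n} (inj₁ F⊢◇G) = inj₁ (mono (nab n) F⊢◇G ⨾ ∇◇-absorb)
∇◇-linear (inj₂ G⊢∇F) = inj₂ (◇∇ ⨾ ∇-lift G⊢∇F)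

corollary2 : (n : ℕ) (X Y : Fm) → InSet n X → InSet n Y → (X ⊢ Y) ⊎ (Y ⊢ X)
corollary2 n _ _ (F , iF , inj₁ ≡-refl) (G , iG , inj₁ ≡-refl) = ◇-linear (comparable n iF iG)
corollary2 n _ _ (F , iF , inj₂ ≡-refl) (G , iG , inj₂ ≡-refl) = ∇-linear (comparable n iF iG)
corollary2 n _ _ (F , iF , inj₂ ≡-refl) (G , iG , inj₁ ≡-refl) = ∇◇-linear (comparable n iF iG)
corollary2 n _ _ (F , iF , inj₁ ≡-refl) (G , iG , inj₂ ≡-refl) = swap (∇◇-linear (comparable n iG iF))
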